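{- (Soundness of the liability fragment of CL.) Every formula derivable in the axiomatic system $\mathsf{CL}_{LI}$ described in the context is valid.
   Context: Fix a nonempty finite set $Ag$ of agents and a countable set $AP$ of atoms. A coalition is a subset of $Ag$. For a nonempty set $Ac$ of actions and coalition $A$, a joint action of $A$ is a function $A\to Ac$; $JA_A$ denotes the set of these. A concurrent game model is $M=(St,Ac,av,out,L)$: $St$ nonempty set of states; $Ac$ nonempty set of actions; $av(s,A)\subseteq JA_A$ nonempty for each $s,A$, with $av(s,A)=\{\bigcup_{a\in A}\sigma_a\mid\sigma_a\in av(s,\{a\})\}$ for $A\neq\emptyset$ and $av(s,\emptyset)=\{\emptyset\}$; $out(s,\sigma)$ for $\sigma\in JA_A$ is $\emptyset$ if $\sigma\notin av(s,A)$, a singleton if $A=Ag$ and $\sigma\in av(s,Ag)$, and $\bigcup\{out(s,\sigma')\mid\sigma'\in av(s,Ag),\sigma\subseteq\sigma'\}$ if $A\ne Ag$ and $\sigma\in av(s,A)$; $L:St\to\mathcal P(AP)$. Coalition Logic: $\phi::=p\mid\top\mid\neg\phi\mid\phi\wedge\phi\mid\langle A\rangle\phi$, booleans standard, $M,s\models\langle A\rangle\phi$ iff there is $\sigma_A\in av(s,A)$ with $M,t\models\phi$ for all $t\in out(s,\sigma_A)$; $[A]\phi:=\neg\langle A\rangle\neg\phi$. Valid = true at every pointed model $(M,s)$. $\Phi_{\mathsf{CL}_{LI}}$: $\phi::=\top\mid\bot\mid p\mid\neg p\mid(\phi\wedge\phi)\mid(\phi\vee\phi)\mid[A]\phi$.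 System $\mathsf{CL}_{LI}$: axioms are the propositional tautologies in $\Phi_{\mathsf{CL}_{LI}}$; rules: R1: from $\phi_1,\dots,\phi_n$ infer $\psi$ where $(\phi_1\wedge\dots\wedge\phi_n)\to\psi$ is a propositional tautology; R2: from $\phi$ infer $[A]\phi$; R3: from $[A\cup B](\phi\vee\psi)\vee\chi$ infer $[A]\phi\vee[B]\psi\vee\chi$, where $A\cap B=\emptyset$. -}

module Defs where

open import Data.Nat using (ℕ)
open import Data.Bool using (Bool; true; false; not; _∧_; _∨_)
open import Data.Fin using (Fin)
open import Data.Fin.Subset using (Subset; _∈_; _∪_; _∩_; Empty) renaming (⊤ to Full)
open import Data.Product using (Σ; ∃; _×_)
open import Data.List using (List)
open import Data.List.Relation.Unary.All using (All)
open import Data.Empty using (⊥)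
open import Data.Unit using (⊤)
open import Relation.Binary.PropositionalEquality using (_≡_)
open import Relation.Nullary using (¬_)

-- Agents Ag = Fin n, atoms AP (an arbitrary type; countability is assumed in the statement).
module CL (n : ℕ) (AP : Set) where

  Coalition : Set
  Coalition = Subset n

  -- Concurrent game models
  -- av(s,{a}) is given as the set of actions available to agent a at s
  -- (a joint action of the singleton {a} is just an action);
  -- av(s,A) for arbitrary A is then determined as in the paper.
  -- out(s,σ) for a full joint action σ ∈ av(s,Ag) is the singleton {δ s σ}.
  record CGM : Set₁ where
    field
      St      : Set
      Ac      : Set
      st₀     : St
      ac₀     : Ac
      avAg    : St → Fin n → Ac → Set
      avAg-ne : ∀ s a → ∃ λ (x : Ac) → avAg s a x
      δ       : St → (Fin n → Ac) → St
      L       : St → AP → Bool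

    JA : Coalition → Set
    JA A = (a : Fin n) → a ∈ A → Ac

    av : St → (A : Coalition) → JA A → Set
    av s A σ = (a : Fin n) (p : a ∈ A) → avAg s a (σ a p)

    av-full : St → (Fin n → Ac) → Set
    av-full s σ = (a : Fin n) → avAg s a (σ a)

    -- t ∈ out(s,σ) for σ ∈ JA_A: t is the outcome of an available full
    -- joint action extending σ (empty if σ ∉ av(s,A)).
    out : St → (A : Coalition) → JA A → St → Set
    out s A σ t = Σ (Fin n → Ac) λ σ' →
      av-full s σ' × ((a : Fin n) (p : a ∈ A) → σ a p ≡ σ' a) × (t ≡ δ s σ')

  data Fm : Set where
    atom : AP → Fm
    ⊤ᶠ   : Fm
    ¬ᶠ_  : Fm → Fm
    _∧ᶠ_ : Fm → Fm → Fm
    ⟨_⟩_ : Coalition → Fm → Fm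

  _,_⊨_ : (M : CGM) → CGM.St M → Fm → Set
  M , s ⊨ atom p   = CGM.L M s p ≡ true
  M , s ⊨ ⊤ᶠ       = ⊤
  M , s ⊨ (¬ᶠ φ)   = ¬ (M , s ⊨ φ)
  M , s ⊨ (φ ∧ᶠ ψ) = (M , s ⊨ φ) × (M , s ⊨ ψ)
  M , s ⊨ (⟨ A ⟩ φ) = Σ (CGM.JA M A) λ σ →
      CGM.av M s A σ × (∀ t → CGM.out M s A σ t → M , t ⊨ φ)

  [_]ᶠ_ : Coalition → Fm → Fm
  [ A ]ᶠ φ = ¬ᶠ (⟨ A ⟩ (¬ᶠ φ))

  Valid : Fm → Set₁
  Valid φ = (M : CGM) (s : CGM.St M) → M , s ⊨ φ

  data LI : Set where
    ⊤ˡ ⊥ˡ : LI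
    pos   : AP → LI
    neg   : AP → LI
    _∧ˡ_  : LI → LI → LI
    _∨ˡ_  : LI → LI → LI
    [_]ˡ_ : Coalition → LI → LI

  ⌜_⌝ : LI → Fm
  ⌜ ⊤ˡ ⌝       = ⊤ᶠ
  ⌜ ⊥ˡ ⌝       = ¬ᶠ ⊤ᶠ
  ⌜ pos p ⌝    = atom p
  ⌜ neg p ⌝    = ¬ᶠ atom p
  ⌜ φ ∧ˡ ψ ⌝   = ⌜ φ ⌝ ∧ᶠ ⌜ ψ ⌝
  ⌜ φ ∨ˡ ψ ⌝   = ¬ᶠ ((¬ᶠ ⌜ φ ⌝) ∧ᶠ (¬ᶠ ⌜ ψ ⌝))
  ⌜ [ A ]ˡ φ ⌝ = [ A ]ᶠ ⌜ φ ⌝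

  -- Propositional tautologies: propositional atoms are the p ∈ AP and
  -- the modal formulas [A]φ; a valuation assigns Bool to each of them.
  eval : (AP → Bool) → (Coalition → LI → Bool) → LI → Bool
  eval V W ⊤ˡ          = true
  eval V W ⊥ˡ          = false
  eval V W (pos p)     = V p
  eval V W (neg p)     = not (V p)
  eval V W (φ ∧ˡ ψ)    = eval V W φ ∧ eval V W ψ
  eval V W (φ ∨ˡ ψ)    = eval V W φ ∨ eval V W ψ
  eval V W ([ A ]ˡ φ)  = W A φ

  Tautology : LI → Set
  Tautology φ = ∀ V W → eval V W φ ≡ true

  TautImp : List LI → LI → Set
  TautImp Φ ψ = ∀ V W → All (λ φ → eval V W φ ≡ true) Φ → eval V W ψ ≡ true

  data ⊢_ : LI → Set where
    ax : ∀ {φ} → Tautology φ → ⊢ φ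
    R1 : ∀ (Φ : List LI) {ψ} → All ⊢_ Φ → TautImp Φ ψ → ⊢ ψ
    R2 : ∀ (A : Coalition) {φ} → ⊢ φ → ⊢ ([ A ]ˡ φ)
    R3 : ∀ (A B : Coalition) {φ ψ χ} → Empty (A ∩ B) →
         ⊢ (([ A ∪ B ]ˡ (φ ∨ˡ ψ)) ∨ˡ χ) →
         ⊢ ((([ A ]ˡ φ) ∨ˡ ([ B ]ˡ ψ)) ∨ˡ χ)

{-# OPTIONS --safe #-}
module Submission where

-- Satisfaction of a liability formula is ¬¬-stable, so it suffices to refute its failure,
-- and under a double negation the finitely many modal atoms [A]ψ occurring in a rule
-- instance can be decided.  A Boolean valuation that reads off these decisions evaluates
-- each of the formulas involved to its truth value, so propositional tautologies and
-- tautological consequences are sound; building that valuation needs decidable equality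
-- of formulas, which is where the injection of the atoms into ℕ enters.  R2 is sound
-- because every available joint action of a coalition extends to an available full
-- action, so outcome sets are nonempty.  R3 is the dual of superadditivity: available
-- actions of disjoint coalitions combine into an action of their union whose outcomes
-- are outcomes of both.

open import Defs
open import Data.Nat using (ℕ; suc) renaming (_≟_ to _ℕ≟_)
open import Function.Bundles using (_↣_)
open import Function using (_∘_)
open import Data.Bool using (Bool; true; false; not; _∧_; _∨_; if_then_else_)
open import Data.Bool.Properties using (not-involutive) renaming (_≟_ to _≟ᵇ_)
open import Data.Fin using (Fin)
open import Data.Fin.Subset using (_∈_; _∉_; _⊆_; _∪_; _∩_; Empty)
open import Data.Fin.Subset.Properties using (_∈?_; p⊆p∪q; q⊆p∪q; x∈p∩q⁺)
open import Data.Vec.Properties using (≡-dec)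
open import Data.Vec.Properties.WithK using ([]=-irrelevant)
open import Data.Product using (Σ; _×_; _,_; proj₁; proj₂; uncurry; curry)
open import Data.Product.Properties using () renaming (≡-dec to ×-≡-dec)
open import Data.List using (List; []; _∷_; _++_; concatMap)
open import Data.List.Relation.Unary.All as All using (All; []; _∷_)
open import Data.List.Relation.Unary.All.Properties using (++⁻ˡ; ++⁻ʳ; concat⁻; map⁻)
open import Data.Unit using (tt)
open import Relation.Binary.Definitions using (DecidableEquality)
open import Relation.Binary.PropositionalEquality using (_≡_; refl; sym; trans; cong; cong₂; subst)
open import Relation.Nullary.Decidable using (Dec; yes; no; does; proof; map′; _×-dec_; ¬¬-excluded-middle; decidable-stable; via-injection)
open import Relation.Nullary.Negation using (¬_; Stable; negated-stable; ¬¬-map; contradiction)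
open import Relation.Nullary.Reflects using (Reflects; ofʸ; ofⁿ; invert; det; ¬-reflects; _×-reflects_)

≡true-reflects : ∀ b → Reflects (b ≡ true) b
≡true-reflects true  = ofʸ refl
≡true-reflects false = ofⁿ (λ ())

not[not∧not]≡∨ : ∀ a b → not (not a ∧ not b) ≡ a ∨ b
not[not∧not]≡∨ true  b = refl
not[not∧not]≡∨ false b = not-involutive b

¬¬-decide-All : ∀ {K : Set} {P : K → Set} (ks : List K) → ¬ ¬ All (Dec ∘ P) ks
¬¬-decide-All []       k = k []
¬¬-decide-All (_ ∷ ks) k = ¬¬-excluded-middle λ d → ¬¬-decide-All ks (k ∘ (d ∷_))

module DecisionTable {K : Set} (_≟_ : DecidableEquality K) {P : K → Set} where

  decisionTable : ∀ {ks} → All (Dec ∘ P) ks → K → Bool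
  decisionTable []                k = false
  decisionTable {k′ ∷ _} (d ∷ ds) k = if does (k ≟ k′) then does d else decisionTable ds k

  decisionTable-reflects : ∀ {ks} (ds : All (Dec ∘ P) ks) →
                           All (λ k → Reflects (P k) (decisionTable ds k)) ks
  decisionTable-reflects []                = []
  decisionTable-reflects {k′ ∷ _} (d ∷ ds) =
    extend (λ k′≢k′ → contradiction refl k′≢k′) ∷
    All.map (λ r → extend (λ _ → r)) (decisionTable-reflects ds)
    where
    extend : ∀ {k} → (¬ k ≡ k′ → Reflects (P k) (decisionTable ds k)) →
             Reflects (P k) (decisionTable (d ∷ ds) k)
    extend {k} r with k ≟ k′
    ... | yes refl = proof d
    ... | no  k≢k′ = r k≢k′

module GameSemantics (n : ℕ) (AP : Set) (M : CL.CGM n AP) where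
  open CL n AP
  open CGM M

  infix 4 _⊨_
  _⊨_ : St → Fm → Set
  _⊨_ = _,_⊨_ M

  Restricts : ∀ {A} → JA A → (Fin n → Ac) → Set
  Restricts {A} σ τ = ∀ a (a∈A : a ∈ A) → σ a a∈A ≡ τ a

  override : ∀ {A} → JA A → (Fin n → Ac) → Fin n → Ac
  override {A} σ τ a with a ∈? A
  ... | yes a∈A = σ a a∈A
  ... | no  _   = τ a

  module _ {A : Coalition} {σ : JA A} {τ : Fin n → Ac} where

    override-restricts : Restricts σ (override σ τ)
    override-restricts a a∈A with a ∈? A
    ... | yes a∈A′ = cong (σ a) ([]=-irrelevant a∈A a∈A′)
    ... | no  a∉A  = contradiction a∈A a∉A

    override-∉ : ∀ {a} → a ∉ A → override σ τ a ≡ τ a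
    override-∉ {a} a∉A with a ∈? A
    ... | yes a∈A = contradiction a∈A a∉A
    ... | no  _   = refl

    override-av : ∀ {s} → av s A σ → av-full s τ → av-full s (override σ τ)
    override-av avσ avτ a with a ∈? A
    ... | yes a∈A = avσ a a∈A
    ... | no  _   = avτ a

  defaultAction : St → Fin n → Ac
  defaultAction s a = proj₁ (avAg-ne s a)

  defaultAction-av : ∀ s → av-full s (defaultAction s)
  defaultAction-av s a = proj₂ (avAg-ne s a)

  out-restrict : ∀ {s A C t} {σ : JA A} {τ : Fin n → Ac} → A ⊆ C → Restricts σ τ →
                 out s C (λ a _ → τ a) t → out s A σ t
  out-restrict A⊆C σ⊑τ (τ′ , avτ′ , τ⊑τ′ , t≡) =
    τ′ , avτ′ , (λ a a∈A → trans (σ⊑τ a a∈A) (τ⊑τ′ a (A⊆C a∈A))) , t≡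

  ⟨⟩-mono : ∀ {s A α β} → (∀ t → t ⊨ α → t ⊨ β) → s ⊨ ⟨ A ⟩ α → s ⊨ ⟨ A ⟩ β
  ⟨⟩-mono α⇒β (σ , avσ , forces) = σ , avσ , λ t o → α⇒β t (forces t o)

  ⟨⟩-superadditive : ∀ {s A B α β} → Empty (A ∩ B) →
                     s ⊨ ⟨ A ⟩ α → s ⊨ ⟨ B ⟩ β → s ⊨ ⟨ A ∪ B ⟩ (α ∧ᶠ β)
  ⟨⟩-superadditive {s} {A} {B} A∩B≡∅ (σA , avA , forcesA) (σB , avB , forcesB) =
    (λ a _ → τ a) , (λ a _ → avτ a) ,
    λ t o → forcesA t (out-restrict (p⊆p∪q B) σA⊑τ o) , forcesB t (out-restrict (q⊆p∪q A B) σB⊑τ o)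
    where
    τ : Fin n → Ac
    τ = override σA (override σB (defaultAction s))
    avτ : av-full s τ
    avτ = override-av avA (override-av avB (defaultAction-av s))
    σA⊑τ : Restricts σA τ
    σA⊑τ = override-restricts
    σB⊑τ : Restricts σB τ
    σB⊑τ a a∈B = trans (override-restricts a a∈B)
                       (sym (override-∉ λ a∈A → A∩B≡∅ (a , x∈p∩q⁺ (a∈A , a∈B))))

  []-necessitation : ∀ {s A α} → (∀ t → t ⊨ α) → s ⊨ [ A ]ᶠ α
  []-necessitation {s} ⊨α (σ , avσ , forces¬α) =
    forces¬α (δ s τ) (τ , avτ , override-restricts , refl) (⊨α (δ s τ))
    where
    τ : Fin n → Ac
    τ = override σ (defaultAction s)
    avτ : av-full s τ
    avτ = override-av avσ (defaultAction-av s)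

  []-union-split : ∀ {s A B} φ ψ → Empty (A ∩ B) →
                   s ⊨ ⌜ [ A ∪ B ]ˡ (φ ∨ˡ ψ) ⌝ → s ⊨ ⌜ ([ A ]ˡ φ) ∨ˡ ([ B ]ˡ ψ) ⌝
  []-union-split φ ψ A∩B≡∅ ⊨[A∪B] (¬¬⟨A⟩¬φ , ¬¬⟨B⟩¬ψ) =
    ¬¬⟨A⟩¬φ λ ⟨A⟩¬φ → ¬¬⟨B⟩¬ψ λ ⟨B⟩¬ψ →
      ⊨[A∪B] (⟨⟩-mono {α = (¬ᶠ ⌜ φ ⌝) ∧ᶠ (¬ᶠ ⌜ ψ ⌝)} {β = ¬ᶠ ⌜ φ ∨ˡ ψ ⌝}
                      ¬φ∧¬ψ⇒¬[φ∨ψ] (⟨⟩-superadditive A∩B≡∅ ⟨A⟩¬φ ⟨B⟩¬ψ))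
    where
    ¬φ∧¬ψ⇒¬[φ∨ψ] : ∀ t → t ⊨ (¬ᶠ ⌜ φ ⌝) ∧ᶠ (¬ᶠ ⌜ ψ ⌝) → t ⊨ ¬ᶠ ⌜ φ ∨ˡ ψ ⌝
    ¬φ∧¬ψ⇒¬[φ∨ψ] _ ¬φ×¬ψ ⊨φ∨ψ = ⊨φ∨ψ ¬φ×¬ψ

  ⌜⌝-stable : ∀ {s} φ → Stable (s ⊨ ⌜ φ ⌝)
  ⌜⌝-stable ⊤ˡ           _ = tt
  ⌜⌝-stable ⊥ˡ             = negated-stable
  ⌜⌝-stable {s} (pos p)    = decidable-stable (L s p ≟ᵇ true)
  ⌜⌝-stable (neg p)        = negated-stable
  ⌜⌝-stable (φ ∧ˡ ψ) ¬¬φ∧ψ = ⌜⌝-stable φ (¬¬-map proj₁ ¬¬φ∧ψ) , ⌜⌝-stable ψ (¬¬-map proj₂ ¬¬φ∧ψ)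
  ⌜⌝-stable (φ ∨ˡ ψ)       = negated-stable
  ⌜⌝-stable ([ A ]ˡ φ)     = negated-stable

module FormulaEquality (n : ℕ) (AP : Set) (_≟ᴬ_ : DecidableEquality AP) where
  open CL n AP

  private
    constructorIndex : LI → ℕ
    constructorIndex ⊤ˡ         = 0
    constructorIndex ⊥ˡ         = 1
    constructorIndex (pos _)    = 2
    constructorIndex (neg _)    = 3
    constructorIndex (_ ∧ˡ _)   = 4
    constructorIndex (_ ∨ˡ _)   = 5
    constructorIndex ([ _ ]ˡ _) = 6

  _≟ᶜ_ : DecidableEquality Coalition
  _≟ᶜ_ = ≡-dec _≟ᵇ_

  -- Comparing constructor indices first lets the unifier discharge all mismatched pairs.
  infix 4 _≟ˡ_
  _≟ˡ_ : DecidableEquality LI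
  φ ≟ˡ ψ with constructorIndex φ ℕ≟ constructorIndex ψ
  ... | no  i≢j = no (i≢j ∘ cong constructorIndex)
  ... | yes i≡j = ≟-sameConstructor φ ψ i≡j
    where
    ≟-sameConstructor : ∀ φ ψ → constructorIndex φ ≡ constructorIndex ψ → Dec (φ ≡ ψ)
    ≟-sameConstructor ⊤ˡ ⊤ˡ _ = yes refl
    ≟-sameConstructor ⊥ˡ ⊥ˡ _ = yes refl
    ≟-sameConstructor (pos p) (pos q) _ = map′ (cong pos) (λ { refl → refl }) (p ≟ᴬ q)
    ≟-sameConstructor (neg p) (neg q) _ = map′ (cong neg) (λ { refl → refl }) (p ≟ᴬ q)
    ≟-sameConstructor (φ ∧ˡ φ′) (ψ ∧ˡ ψ′) _ =
      map′ (uncurry (cong₂ _∧ˡ_)) (λ { refl → refl , refl }) (φ ≟ˡ ψ ×-dec φ′ ≟ˡ ψ′)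
    ≟-sameConstructor (φ ∨ˡ φ′) (ψ ∨ˡ ψ′) _ =
      map′ (uncurry (cong₂ _∨ˡ_)) (λ { refl → refl , refl }) (φ ≟ˡ ψ ×-dec φ′ ≟ˡ ψ′)
    ≟-sameConstructor ([ A ]ˡ φ) ([ B ]ˡ ψ) _ =
      map′ (uncurry (cong₂ [_]ˡ_)) (λ { refl → refl , refl }) (A ≟ᶜ B ×-dec φ ≟ˡ ψ)

module Soundness (n : ℕ) (AP : Set) (_≟ᴬ_ : DecidableEquality AP) where
  open CL n AP
  open FormulaEquality n AP _≟ᴬ_

  ModalAtom : Set
  ModalAtom = Coalition × LI

  _≟ᵐ_ : DecidableEquality ModalAtom
  _≟ᵐ_ = ×-≡-dec _≟ᶜ_ _≟ˡ_

  modalAtoms : LI → List ModalAtom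
  modalAtoms ⊤ˡ         = []
  modalAtoms ⊥ˡ         = []
  modalAtoms (pos _)    = []
  modalAtoms (neg _)    = []
  modalAtoms (φ ∧ˡ ψ)   = modalAtoms φ ++ modalAtoms ψ
  modalAtoms (φ ∨ˡ ψ)   = modalAtoms φ ++ modalAtoms ψ
  modalAtoms ([ A ]ˡ φ) = (A , φ) ∷ []

  module _ (M : CGM) (s : CGM.St M) where
    open CGM M using (L)
    open GameSemantics n AP M using (_⊨_; ⌜⌝-stable)
    open DecisionTable _≟ᵐ_

    Holds : ModalAtom → Set
    Holds (A , φ) = s ⊨ ⌜ [ A ]ˡ φ ⌝

    Faithful : (ModalAtom → Bool) → ModalAtom → Set
    Faithful W x = Reflects (Holds x) (W x)

    eval-reflects : ∀ {W} φ → All (Faithful W) (modalAtoms φ) →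
                    Reflects (s ⊨ ⌜ φ ⌝) (eval (L s) (curry W) φ)
    eval-reflects ⊤ˡ         _ = ofʸ tt
    eval-reflects ⊥ˡ         _ = ¬-reflects (ofʸ tt)
    eval-reflects (pos p)    _ = ≡true-reflects (L s p)
    eval-reflects (neg p)    _ = ¬-reflects (≡true-reflects (L s p))
    eval-reflects (φ ∧ˡ ψ)   f = eval-reflects φ (++⁻ˡ _ f) ×-reflects eval-reflects ψ (++⁻ʳ _ f)
    eval-reflects {W} (φ ∨ˡ ψ) f =
      subst (Reflects _) (not[not∧not]≡∨ (eval (L s) (curry W) φ) (eval (L s) (curry W) ψ))
            (¬-reflects (¬-reflects (eval-reflects φ (++⁻ˡ _ f)) ×-reflects
                         ¬-reflects (eval-reflects ψ (++⁻ʳ _ f))))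
    eval-reflects ([ A ]ˡ φ) (f ∷ []) = f

    ¬¬-faithfulValuation : ∀ xs → ¬ ¬ Σ (ModalAtom → Bool) λ W → All (Faithful W) xs
    ¬¬-faithfulValuation xs =
      ¬¬-map (λ ds → decisionTable ds , decisionTable-reflects ds) (¬¬-decide-All xs)

    tautImp-sound : ∀ {Φ ψ} → TautImp Φ ψ → All (λ φ → s ⊨ ⌜ φ ⌝) Φ → s ⊨ ⌜ ψ ⌝
    tautImp-sound {Φ} {ψ} taut ⊨Φ =
      ⌜⌝-stable ψ (¬¬-map conclude (¬¬-faithfulValuation (concatMap modalAtoms (ψ ∷ Φ))))
      where
      conclude : Σ (ModalAtom → Bool) (λ W → All (Faithful W) (concatMap modalAtoms (ψ ∷ Φ))) → s ⊨ ⌜ ψ ⌝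
      conclude (W , faithful) with map⁻ {xs = ψ ∷ Φ} (concat⁻ faithful)
      ... | faithfulψ ∷ faithfulΦ =
        invert (subst (Reflects _) (taut (L s) (curry W) evalΦ) (eval-reflects ψ faithfulψ))
        where
        evalΦ : All (λ φ → eval (L s) (curry W) φ ≡ true) Φ
        evalΦ = All.zipWith (λ (f , ⊨φ) → det (eval-reflects _ f) (ofʸ ⊨φ)) (faithfulΦ , ⊨Φ)

  mutual
    sound : ∀ {φ} → ⊢ φ → Valid ⌜ φ ⌝
    sound (ax taut)          M s = tautImp-sound M s (λ V W _ → taut V W) []
    sound (R1 Φ ⊢Φ taut)     M s = tautImp-sound M s taut (sound-All ⊢Φ M s)
    sound (R2 A ⊢φ)          M s = []-necessitation (sound ⊢φ M)
      where open GameSemantics n AP M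
    sound (R3 A B {φ} {ψ} A∩B≡∅ ⊢premise) M s (¬[A]φ∨[B]ψ , ¬χ) =
      sound ⊢premise M s (¬[A]φ∨[B]ψ ∘ []-union-split φ ψ A∩B≡∅ , ¬χ)
      where open GameSemantics n AP M

    sound-All : ∀ {Φ} → All ⊢_ Φ → ∀ M s → All (λ φ → M , s ⊨ ⌜ φ ⌝) Φ
    sound-All []         M s = []
    sound-All (⊢φ ∷ ⊢Φ) M s = sound ⊢φ M s ∷ sound-All ⊢Φ M s

mainTheorem6 : (k : ℕ) (AP : Set) → AP ↣ ℕ →
    (φ : CL.LI (suc k) AP) → CL.⊢_ (suc k) AP φ → CL.Valid (suc k) AP (CL.⌜_⌝ (suc k) AP φ)
mainTheorem6 k AP AP↣ℕ _ = Soundness.sound (suc k) AP (via-injection AP↣ℕ _ℕ≟_)
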